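{- Let $A$ be an admissible set of addition chains. No nonzero integer equals $\delta^A(n)$ for any positive integer $n$.
   Context: An addition chain for a positive integer $n$ is a sequence $(a_0,\ldots,a_r)$ with $a_0=1$, $a_r=n$, and for every $1\le k\le r$ there exist $0\le i,j<k$ with $a_k=a_i+a_j$; $r$ is its length. For a set $A$ of addition chains, $\ell^A(n)$ is the least length of an addition chain for $n$ belonging to $A$. $\nu_2(n)$ is the number of $1$'s in the binary expansion of $n$. $A$ is admissible if (i) for every $n\ge1$, $\ell^A(n)$ is defined and $\ell^A(n)\le\lfloor\log_2 n\rfloor+\nu_2(n)-1$, and (ii) for every $n\ge1$, $\ell^A(2n)\le\ell^A(n)+1$. The $A$-defect is $\delta^A(n)=\ell^A(n)-\log_2 n$. -}

module Defs where

open import Data.Nat using (ℕ; zero; suc; _+_; _*_; _∸_; _^_; _≤_; _%_; _/_)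
open import Data.Nat.Logarithm using (⌊log₂_⌋)
open import Data.Fin as Fin using (Fin; toℕ; fromℕ)
open import Data.Product using (Σ; ∃; ∃₂; _×_)
open import Data.Integer as ℤ using (ℤ; +_)
open import Relation.Binary.PropositionalEquality using (_≡_)

record AddChain : Set where
  field
    len   : ℕ
    seq   : Fin (suc len) → ℕ
    start : seq Fin.zero ≡ 1
    step  : (k : Fin (suc len)) → 0 Data.Nat.< toℕ k →
            ∃₂ λ (i j : Fin (suc len)) → (i Fin.< k) × (j Fin.< k) × (seq k ≡ seq i + seq j)

open AddChain public

ChainFor : ℕ → AddChain → Set
ChainFor n c = seq c (fromℕ (len c)) ≡ n

ChainSet : Set₁
ChainSet = AddChain → Set

IsℓA : ChainSet → ℕ → ℕ → Set
IsℓA A n r =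
  (Σ AddChain λ c → A c × ChainFor n c × len c ≡ r) ×
  ((c : AddChain) → A c → ChainFor n c → r ≤ len c)

-- ν₂(n): number of 1's in the binary expansion of n (fuel n suffices)
νAux : ℕ → ℕ → ℕ
νAux zero    _ = 0
νAux (suc f) m = m % 2 + νAux f (m / 2)

ν₂ : ℕ → ℕ
ν₂ n = νAux n n

record Admissible (A : ChainSet) : Set where
  field
    bound   : (n : ℕ) → 1 ≤ n →
              Σ ℕ λ r → IsℓA A n r × (r ≤ (⌊log₂ n ⌋ + ν₂ n) ∸ 1)
    doubling : (n r r′ : ℕ) → 1 ≤ n → IsℓA A n r → IsℓA A (2 * n) r′ →
               r′ ≤ suc r

-- "log₂ n = m" for a natural number m (log₂ n ≥ 0 for n ≥ 1, so a value
-- of log₂ n that is an integer is a natural number m with 2^m = n)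
Log₂Is : ℕ → ℕ → Set
Log₂Is n m = 2 ^ m ≡ n

-- "δ^A(n) = k" for an integer k: ℓ^A(n) = r and r − log₂ n = k.
-- Since r and k are integers, this forces log₂ n = r − k to be an integer m.
DefectIs : ChainSet → ℕ → ℤ → Set
DefectIs A n k =
  Σ ℕ λ r → IsℓA A n r × (Σ ℕ λ m → Log₂Is n m × ((+ r) ℤ.- (+ m) ≡ k))

{-# OPTIONS --safe #-}
module Submission where

-- If δ^A(n) is an integer then log₂ n is, so n = 2^m. Every term of an addition
-- chain is at most twice the largest earlier one, so a chain of length r only
-- reaches numbers ≤ 2^r and ℓ^A(2^m) ≥ m. Conversely ℓ^A(1) = 0 by the
-- admissibility bound and m doublings give ℓ^A(2^m) ≤ m. Hence δ^A(2^m) = 0.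

open import Defs
open import Data.Nat using (ℕ; zero; suc; _+_; _^_; _≤_; s≤s; z≤n; s≤s⁻¹)
open import Data.Nat.Properties
open import Data.Integer using (ℤ; +_)
open import Data.Integer.Properties using (i≡j⇒i-j≡0)
open import Data.Fin using (Fin; toℕ; fromℕ)
import Data.Fin as Fin
open import Data.Fin.Properties using (toℕ-fromℕ)
open import Data.Product using (Σ; _,_; _×_)
open import Relation.Binary.PropositionalEquality
open import Relation.Nullary using (¬_)

IsℓA-unique : ∀ {A n r r′} → IsℓA A n r → IsℓA A n r′ → r ≡ r′
IsℓA-unique ((c , Ac , c-for-n , refl) , minimal) ((c′ , Ac′ , c′-for-n , refl) , minimal′) =
  ≤-antisym (minimal c′ Ac′ c′-for-n) (minimal′ c Ac c-for-n)

seq≤2^index : (c : AddChain) (k : Fin (suc (len c))) → seq c k ≤ 2 ^ toℕ k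
seq≤2^index c k = seq≤2^ (toℕ k) k ≤-refl
  where
  seq≤2^ : ∀ t (k : Fin (suc (len c))) → toℕ k ≤ t → seq c k ≤ 2 ^ t
  seq≤2^ t       Fin.zero    _  = subst (_≤ 2 ^ t) (sym (start c)) (m^n>0 2 t)
  seq≤2^ (suc t) (Fin.suc k) k<t with step c (Fin.suc k) (s≤s z≤n)
  ... | i , j , i<k , j<k , k≡i+j = begin
    seq c (Fin.suc k)   ≡⟨ k≡i+j ⟩
    seq c i + seq c j   ≤⟨ +-mono-≤ (earlier i i<k) (earlier j j<k) ⟩
    2 ^ t + 2 ^ t       ≡⟨ cong (_+_ (2 ^ t)) (sym (+-identityʳ (2 ^ t))) ⟩
    2 ^ suc t           ∎
    where
    open ≤-Reasoning
    earlier : ∀ i → i Fin.< Fin.suc k → seq c i ≤ 2 ^ t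
    earlier i i<k = seq≤2^ t i (s≤s⁻¹ (≤-trans i<k k<t))

ChainFor⇒≤2^len : ∀ {n} c → ChainFor n c → n ≤ 2 ^ len c
ChainFor⇒≤2^len c refl =
  subst (λ e → seq c (fromℕ (len c)) ≤ 2 ^ e) (toℕ-fromℕ (len c)) (seq≤2^index c (fromℕ (len c)))

2^-cancel-≤ : ∀ {m n} → 2 ^ m ≤ 2 ^ n → m ≤ n
2^-cancel-≤ 2^m≤2^n = ≮⇒≥ (λ n<m → <⇒≱ (^-monoʳ-< 2 (s≤s (s≤s z≤n)) n<m) 2^m≤2^n)

IsℓA-2^-lower : ∀ {A m r} → IsℓA A (2 ^ m) r → m ≤ r
IsℓA-2^-lower ((c , _ , c-for-2^m , refl) , _) = 2^-cancel-≤ (ChainFor⇒≤2^len c c-for-2^m)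

IsℓA-2^-upper : ∀ {A} → Admissible A → ∀ m → Σ ℕ λ r → IsℓA A (2 ^ m) r × r ≤ m
IsℓA-2^-upper adm zero with Admissible.bound adm 1 (s≤s z≤n)
... | r , ℓ[1]≡r , r≤0 = r , ℓ[1]≡r , r≤0
IsℓA-2^-upper adm (suc m) with IsℓA-2^-upper adm m | Admissible.bound adm (2 ^ suc m) (m^n>0 2 (suc m))
... | r , ℓ[2^m]≡r , r≤m | r′ , ℓ[2^1+m]≡r′ , _ =
  r′ , ℓ[2^1+m]≡r′ , ≤-trans (Admissible.doubling adm (2 ^ m) r r′ (m^n>0 2 m) ℓ[2^m]≡r ℓ[2^1+m]≡r′) (s≤s r≤m)

IsℓA-2^ : ∀ {A m r} → Admissible A → IsℓA A (2 ^ m) r → r ≡ m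
IsℓA-2^ {m = m} adm ℓ[2^m]≡r with IsℓA-2^-upper adm m
... | r′ , ℓ[2^m]≡r′ , r′≤m =
  ≤-antisym (subst (_≤ m) (IsℓA-unique ℓ[2^m]≡r′ ℓ[2^m]≡r) r′≤m) (IsℓA-2^-lower ℓ[2^m]≡r)

corollary3p5 : (A : ChainSet) → Admissible A →
    (n : ℕ) → 1 ≤ n → (k : ℤ) → k ≢ + 0 → ¬ DefectIs A n k
corollary3p5 A adm n _ k k≢0 (r , ℓ[n]≡r , m , refl , refl) =
  k≢0 (i≡j⇒i-j≡0 (cong +_ (IsℓA-2^ {m = m} adm ℓ[n]≡r)))
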